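{- Let $v\geq 8$ and let $C_v$ be the configuration with point set $\mathbb{Z}_v=\{0,1,\dots,v-1\}$ and blocks $\{i,i+1,i+3\}$ for $i\in\mathbb{Z}_v$. Let $S$ be a blocking set of $C_v$ and let $\mathbf{b}(S)=b_0b_1\cdots b_{v-1}$ be the circular binary word with $b_i=1$ if $i\in S$ and $b_i=0$ otherwise. Then either (a) $\mathbf{b}(S)$ is $0101\cdots01$ or $1010\cdots10$ (which is possible only if $v$ is even), or (b) every maximal run of consecutive equal digits in the circular word $\mathbf{b}(S)$ has length $2$ or $3$.
   Context: A blocking set is a subset $S$ of the points such that every block contains at least one point of $S$ and at least one point not in $S$. A circular binary word of length $n$ is a sequence $b_0,\dots,b_{n-1}\in\{0,1\}$ with $b_0$ regarded as following $b_{n-1}$. A run of length $k$ is a maximal sequence of $k$ cyclically consecutive equal digits (a block of $k$ consecutive 1s bordered by 0s on both sides, or of $k$ consecutive 0s bordered by 1s). -}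

module Defs where

open import Data.Nat using (ℕ; zero; suc; _+_; _∸_; _<_; _≤_; NonZero; _≡ᵇ_)
open import Data.Nat.DivMod using (_%_; m%n<n)
open import Data.Sum using (_⊎_)
open import Data.Fin using (Fin; fromℕ<)
open import Data.Bool using (Bool; true; false; not)
open import Data.Product using (_×_)
open import Relation.Binary.PropositionalEquality using (_≡_; _≢_)

-- A subset S of the point set ℤ_v = Fin v is given by its characteristic
-- function; this is exactly the circular binary word b(S): b_i = true (1) iff i ∈ S.
Subset : ℕ → Set
Subset v = Fin v → Bool

pt : (v : ℕ) .{{_ : NonZero v}} → ℕ → Fin v
pt v i = fromℕ< (m%n<n i v)

letter : (v : ℕ) .{{_ : NonZero v}} → Subset v → ℕ → Bool
letter v S i = S (pt v i)

IsBlockingSet : (v : ℕ) .{{_ : NonZero v}} → Subset v → Set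
IsBlockingSet v S =
  (i : ℕ) → i < v →
    ((letter v S i ≡ true) ⊎ (letter v S (i + 1) ≡ true) ⊎ (letter v S (i + 3) ≡ true))
  × ((letter v S i ≡ false) ⊎ (letter v S (i + 1) ≡ false) ⊎ (letter v S (i + 3) ≡ false))

IsAlt01 : (v : ℕ) .{{_ : NonZero v}} → Subset v → Set
IsAlt01 v S = (i : ℕ) → i < v → letter v S i ≡ (i % 2 ≡ᵇ 1)

IsAlt10 : (v : ℕ) .{{_ : NonZero v}} → Subset v → Set
IsAlt10 v S = (i : ℕ) → i < v → letter v S i ≡ (i % 2 ≡ᵇ 0)

-- A run of length k starting at position i of the circular word:
-- k ≥ 1 cyclically consecutive equal letters b_i = … = b_{i+k-1},
-- maximal: b_{i-1} ≠ b_i and b_{i+k} ≠ b_i  (indices mod v, i-1 written i+v-1).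
IsRun : (v : ℕ) .{{_ : NonZero v}} → Subset v → ℕ → ℕ → Set
IsRun v S i k =
  1 ≤ k × k ≤ v
  × ((j : ℕ) → j < k → letter v S (i + j) ≡ letter v S i)
  × letter v S (i + v ∸ 1) ≢ letter v S i
  × letter v S (i + k) ≢ letter v S i

-- A blocking set cannot contain a whole block {n, n+1, n+3} nor miss one, so the
-- periodic word b = b(S) has no n with b n = b (n+1) = b (n+3).  A run of length
-- ≥ 4 starting at n violates this at n.  If the letters at m+1, m+2, m+3 alternate,
-- then b (m+1) = b (m+3), so b m ≠ b (m+1): alternation propagates backwards.
-- A run of length 1 at i makes the word alternate at i+v-1 and i+v; propagating
-- backwards over a full period shows the whole word alternates.
module Submission where

open import Defs
open import Data.Nat using (ℕ; zero; suc; _+_; _∸_; _<_; _≤_; z≤n; s≤s; NonZero; _≡ᵇ_)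
open import Data.Nat.Properties
  using (+-comm; +-suc; +-identityʳ; ≤-trans; n≤1+n; m≤n+m; <⇒≤; m≤n⇒m<n∨m≡n; allUpTo?)
open import Data.Nat.DivMod using (_%_; m%n<n; m%n%n≡m%n; [m+n]%n≡m%n; %-distribˡ-+)
open import Data.Fin.Properties using (fromℕ<-cong)
open import Data.Sum using (_⊎_; inj₁; inj₂)
open import Data.Product using (_×_; _,_)
open import Data.Empty using (⊥-elim)
open import Data.Bool using (Bool; true; false; not)
open import Data.Bool.Properties using (_≟_; ¬-not; not-involutive)
open import Relation.Nullary using (yes; no; ¬_; ¬?)
open import Relation.Binary.PropositionalEquality
  using (_≡_; _≢_; refl; sym; trans; cong; module ≡-Reasoning)

≢-≢⇒≡ : ∀ {x y z : Bool} → x ≢ y → y ≢ z → x ≡ z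
≢-≢⇒≡ {x} {y} {z} x≢y y≢z = begin
  x             ≡⟨ ¬-not x≢y ⟩
  not y         ≡⟨ cong not (¬-not y≢z) ⟩
  not (not z)   ≡⟨ not-involutive z ⟩
  z             ∎
  where open ≡-Reasoning

odd-suc : ∀ i → (suc i % 2 ≡ᵇ 1) ≡ not (i % 2 ≡ᵇ 1)
odd-suc zero          = refl
odd-suc (suc zero)    = refl
odd-suc (suc (suc i)) = odd-suc i

even-suc : ∀ i → (suc i % 2 ≡ᵇ 0) ≡ not (i % 2 ≡ᵇ 0)
even-suc zero          = refl
even-suc (suc zero)    = refl
even-suc (suc (suc i)) = even-suc i

mixed⇒¬constant : ∀ {x y z : Bool} →
  (x ≡ true ⊎ y ≡ true ⊎ z ≡ true) → (x ≡ false ⊎ y ≡ false ⊎ z ≡ false) →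
  ¬ (x ≡ y × y ≡ z)
mixed⇒¬constant {true}  _ (inj₁ ())          (refl , refl)
mixed⇒¬constant {true}  _ (inj₂ (inj₁ ()))   (refl , refl)
mixed⇒¬constant {true}  _ (inj₂ (inj₂ ()))   (refl , refl)
mixed⇒¬constant {false} (inj₁ ()) _          (refl , refl)
mixed⇒¬constant {false} (inj₂ (inj₁ ())) _   (refl , refl)
mixed⇒¬constant {false} (inj₂ (inj₂ ())) _   (refl , refl)

module Word (b : ℕ → Bool) where

  FlipsAt : ℕ → Set
  FlipsAt n = b n ≢ b (suc n)

  Monochromatic : ℕ → Set
  Monochromatic n = b n ≡ b (suc n) × b (suc n) ≡ b (3 + n)

  Periodic : ℕ → Set
  Periodic v = ∀ n → b (n + v) ≡ b n

  module _ (no-mono : ∀ n → ¬ Monochromatic n) where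

    flips-backward : ∀ m → FlipsAt (1 + m) → FlipsAt (2 + m) → FlipsAt m
    flips-backward m flip₁ flip₂ same =
      no-mono m (same , trans (sym same) (≢-≢⇒≡ (λ e → flip₁ (trans (sym same) e)) flip₂))

    flips-below : ∀ m → FlipsAt m → FlipsAt (suc m) → ∀ {j} → j ≤ suc m → FlipsAt j
    flips-below m flip₀ flip₁ j≤1+m with m≤n⇒m<n∨m≡n j≤1+m
    ... | inj₂ refl = flip₁
    flips-below zero    flip₀ _     _ | inj₁ (s≤s z≤n) = flip₀
    flips-below (suc m) flip₀ flip₁ _ | inj₁ (s≤s j≤1+m) =
      flips-below m (flips-backward m flip₀ flip₁) flip₀ j≤1+m

    -- Modulo u+1, the positions i+u and i+u+1 are i-1 and i.
    singleton-run⇒flips : ∀ u i → Periodic (suc u) →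
      b (i + u) ≢ b i → b (i + 1) ≢ b i → ∀ {j} → j < suc u → FlipsAt j
    singleton-run⇒flips u i periodic before after (s≤s j≤u) =
      flips-below (i + u) flip-before flip-at
        (≤-trans j≤u (≤-trans (m≤n+m u i) (n≤1+n (i + u))))
      where
      wrap : ∀ k → b (suc (k + u)) ≡ b k
      wrap k = trans (cong b (sym (+-suc k u))) (periodic k)
      flip-before : FlipsAt (i + u)
      flip-before e = before (trans e (wrap i))
      flip-at : FlipsAt (suc (i + u))
      flip-at e = after (trans (cong b (+-comm i 1))
                                (trans (sym (wrap (suc i))) (sym (trans (sym (wrap i)) e))))

  alternating : ∀ n (f : ℕ → Bool) → (∀ i → f (suc i) ≡ not (f i)) → b 0 ≡ f 0 →
    (∀ {j} → j < n → FlipsAt j) → ∀ i → i < n → b i ≡ f i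
  alternating n f f-flips start flips zero    _   = start
  alternating n f f-flips start flips (suc i) i<n = begin
    b (suc i)   ≡⟨ ¬-not (λ e → flips (<⇒≤ i<n) (sym e)) ⟩
    not (b i)   ≡⟨ cong not (alternating n f f-flips start flips i (<⇒≤ i<n)) ⟩
    not (f i)   ≡⟨ f-flips i ⟨
    f (suc i)   ∎
    where open ≡-Reasoning

module _ (u : ℕ) (S : Subset (suc u)) where
  word : ℕ → Bool
  word = letter (suc u) S

  open Word word

  word-cong : ∀ m n → m % suc u ≡ n % suc u → word m ≡ word n
  word-cong m n e = cong S (fromℕ<-cong _ _ e (m%n<n m (suc u)) (m%n<n n (suc u)))

  word-periodic : Periodic (suc u)
  word-periodic n = word-cong (n + suc u) n ([m+n]%n≡m%n n (suc u))

  word-mod : ∀ n c → word (n % suc u + c) ≡ word (n + c)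
  word-mod n c = word-cong (n % suc u + c) (n + c) (begin
    (n % v + c) % v            ≡⟨ %-distribˡ-+ (n % v) c v ⟩
    (n % v % v + c % v) % v    ≡⟨ cong (λ r → (r + c % v) % v) (m%n%n≡m%n n v) ⟩
    (n % v + c % v) % v        ≡⟨ %-distribˡ-+ n c v ⟨
    (n + c) % v                ∎)
    where
    v = suc u
    open ≡-Reasoning

  blocking⇒no-monochromatic : IsBlockingSet (suc u) S → ∀ n → ¬ Monochromatic n
  blocking⇒no-monochromatic blocking n (e₁ , e₃) with blocking (n % suc u) (m%n<n n (suc u))
  ... | some-in , some-out = mixed⇒¬constant some-in some-out
    ( trans (cong word (sym (+-identityʳ (n % suc u)))) (trans (lift 0) (trans e₁ (sym (lift 1))))
    , trans (lift 1) (trans e₃ (sym (lift 3))) )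
    where
    lift : ∀ c → word (n % suc u + c) ≡ word (c + n)
    lift c = trans (word-mod n c) (cong word (+-comm n c))

  runs-of-length-2-or-3 : IsBlockingSet (suc u) S → ¬ (∀ {j} → j < suc u → FlipsAt j) →
    ∀ i k → IsRun (suc u) S i k → k ≡ 2 ⊎ k ≡ 3
  runs-of-length-2-or-3 blocking _ i zero (() , _)
  runs-of-length-2-or-3 blocking no-flips i 1 (_ , _ , _ , before , after) =
    ⊥-elim (no-flips (singleton-run⇒flips (blocking⇒no-monochromatic blocking) u i
      word-periodic (λ e → before (trans (cong word (cong (_∸ 1) (+-suc i u))) e)) after))
  runs-of-length-2-or-3 blocking _ i 2 _ = inj₁ refl
  runs-of-length-2-or-3 blocking _ i 3 _ = inj₂ refl
  runs-of-length-2-or-3 blocking _ i (suc (suc (suc (suc k)))) (_ , _ , constant , _ , _) =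
    ⊥-elim (blocking⇒no-monochromatic blocking i (sym at₁ , trans at₁ (sym at₃)))
    where
    at : ∀ j → j < 4 + k → word (j + i) ≡ word i
    at j j<k = trans (cong word (+-comm j i)) (constant j j<k)
    at₁ : word (suc i) ≡ word i
    at₁ = at 1 (s≤s (s≤s z≤n))
    at₃ : word (3 + i) ≡ word i
    at₃ = at 3 (s≤s (s≤s (s≤s (s≤s z≤n))))

  flips⇒alternating : (∀ {j} → j < suc u → FlipsAt j) → IsAlt01 (suc u) S ⊎ IsAlt10 (suc u) S
  flips⇒alternating flips with word 0 in start
  ... | false = inj₁ (alternating (suc u) (λ i → i % 2 ≡ᵇ 1) odd-suc start flips)
  ... | true  = inj₂ (alternating (suc u) (λ i → i % 2 ≡ᵇ 0) even-suc start flips)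

lemma7 : (v : ℕ) → .{{_ : NonZero v}} → 8 ≤ v → (S : Subset v) → IsBlockingSet v S →
    (IsAlt01 v S ⊎ IsAlt10 v S)
    ⊎ ((i k : ℕ) → IsRun v S i k → (k ≡ 2 ⊎ k ≡ 3))
lemma7 (suc u) _ S blocking with allUpTo? (λ j → ¬? (word u S j ≟ word u S (suc j))) (suc u)
... | yes flips    = inj₁ (flips⇒alternating u S flips)
... | no no-flips  = inj₂ (runs-of-length-2-or-3 u S blocking no-flips)
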